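{- Let $n\geq1$. The degree bi-enumerators of the subgraphs of $K_{1,n}$ are precisely the vectors ${\bf 1}_k\oplus(n-k,k)\in\mathbb{R}^{n+1}\oplus\mathbb{R}^{2}$ for $k=0,\dots,n$; all of them are vertices of ${\cal B}_{1,n}$, and ${\cal B}_{1,n}$ is an $n$-dimensional simplex in $\mathbb{R}^{n+1}\oplus\mathbb{R}^{1+1}\cong\mathbb{R}^{n+3}$.
   Context: $K_{m,n}=(U,V,E)$ is the complete bipartite graph with left vertices $U=\{u_1,\dots,u_m\}$, right vertices $V=\{v_1,\dots,v_n\}$ and $E=U\times V$. A subgraph $G\subseteq K_{m,n}$ means a bipartite graph on the same vertex sets $U,V$ with edge set contained in $E$. Its degree bi-enumerator is $b(G)=a(G)\oplus c(G)\in\mathbb{R}^{n+1}\oplus\mathbb{R}^{m+1}$, where $a_k(G)$ ($k=0,\dots,n$) is the number of left vertices of degree $k$ and $c_k(G)$ ($k=0,\dots,m$) is the number of right vertices of degree $k$. Vectors are indexed from $0$, ${\bf 1}_k$ is the $k$-th unit vector, and ${\cal B}_{m,n}:=\mathrm{conv}\{b(G): G\subseteq K_{m,n}\}$ is the degree bi-enumerator polytope.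
   Formalization: The polytope ${\cal B}_{1,n}$ is taken over ℚ: its points have rational coordinates instead of real ones, and its convex weights, the functionals exposing its vertices and the coefficients testing affine independence are rational. -}

module Defs where

open import Data.Nat as ℕ using (ℕ; zero; suc; _∸_; _≡ᵇ_)
open import Data.Bool using (Bool; true; false; if_then_else_)
open import Data.Fin using (Fin; zero; suc; toℕ)
open import Data.Sum using (_⊎_; inj₁; inj₂)
open import Data.Product using (Σ; ∃; _×_; _,_)
open import Data.Integer using (+_)
open import Data.Rational using (ℚ; 0ℚ; 1ℚ; _+_; _*_; _≤_; _<_; _/_)
open import Relation.Binary.PropositionalEquality using (_≡_)
open import Relation.Nullary using (¬_)

ℕtoℚ : ℕ → ℚ
ℕtoℚ k = (+ k) / 1

count : ∀ {k} → (Fin k → Bool) → ℕ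
count {zero}  p = 0
count {suc k} p = (if p zero then 1 else 0) ℕ.+ count (λ i → p (suc i))

∑ : ∀ {k} → (Fin k → ℚ) → ℚ
∑ {zero}  f = 0ℚ
∑ {suc k} f = f zero + ∑ (λ i → f (suc i))

-- A subgraph of K_{m,n} = (U,V,U×V): its edge set, i.e. the predicate
-- "u_i v_j is an edge" for i : Fin m (left), j : Fin n (right).
Graph : ℕ → ℕ → Set
Graph m n = Fin m → Fin n → Bool

degL : ∀ {m n} → Graph m n → Fin m → ℕ
degL G u = count (λ v → G u v)

degR : ∀ {m n} → Graph m n → Fin n → ℕ
degR G v = count (λ u → G u v)

a : ∀ {m n} → Graph m n → Fin (suc n) → ℕ
a G k = count (λ u → degL G u ≡ᵇ toℕ k)

c : ∀ {m n} → Graph m n → Fin (suc m) → ℕ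
c G k = count (λ v → degR G v ≡ᵇ toℕ k)

-- Points of ℝ^{n+1} ⊕ ℝ^{m+1}, coordinates indexed by Fin (n+1) ⊎ Fin (m+1)
-- (we work with rational coordinates).
Idx : ℕ → ℕ → Set
Idx m n = Fin (suc n) ⊎ Fin (suc m)

Pt : ℕ → ℕ → Set
Pt m n = Idx m n → ℚ

b : ∀ {m n} → Graph m n → Idx m n → ℕ
b G (inj₁ k) = a G k
b G (inj₂ k) = c G k

bℚ : ∀ {m n} → Graph m n → Pt m n
bℚ G i = ℕtoℚ (b G i)

target : (n : ℕ) → Fin (suc n) → Idx 1 n → ℕ
target n k (inj₁ i) = if toℕ i ≡ᵇ toℕ k then 1 else 0
target n k (inj₂ zero) = n ∸ toℕ k
target n k (inj₂ (suc zero)) = toℕ k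

InConv : ∀ {m n} → (Pt m n → Set) → Pt m n → Set
InConv {m} {n} S x =
  Σ ℕ λ r → Σ (Fin r → Pt m n) λ p → Σ (Fin r → ℚ) λ w →
    ((i : Fin r) → S (p i)) × ((i : Fin r) → 0ℚ ≤ w i) × (∑ w ≡ 1ℚ)
    × ((j : Idx m n) → x j ≡ ∑ (λ i → w i * p i j))

BiEnums : (m n : ℕ) → Pt m n → Set
BiEnums m n x = Σ (Graph m n) λ G → (j : Idx m n) → x j ≡ bℚ G j

InB : (m n : ℕ) → Pt m n → Set
InB m n = InConv (BiEnums m n)

dot : ∀ {m n} → Pt m n → Pt m n → ℚ
dot {m} {n} w x = ∑ (λ i → w (inj₁ i) * x (inj₁ i)) + ∑ (λ i → w (inj₂ i) * x (inj₂ i))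

PtEq : ∀ {m n} → Pt m n → Pt m n → Set
PtEq {m} {n} y z = (j : Idx m n) → y j ≡ z j

IsVertex : ∀ {m n} → (Pt m n → Set) → Pt m n → Set
IsVertex {m} {n} P x =
  P x × Σ (Pt m n) λ w → (y : Pt m n) → P y → ¬ PtEq y x → dot w y < dot w x

AffInd : ∀ {m n d} → (Fin (suc d) → Pt m n) → Set
AffInd {m} {n} {d} q =
  (l : Fin (suc d) → ℚ) → ∑ l ≡ 0ℚ →
  ((j : Idx m n) → ∑ (λ i → l i * q i j) ≡ 0ℚ) → (i : Fin (suc d)) → l i ≡ 0ℚ

IsSimplex : ∀ {m n} → ℕ → (Pt m n → Set) → Set
IsSimplex {m} {n} d P =
  Σ (Fin (suc d) → Pt m n) λ q → AffInd q ×
    ((x : Pt m n) → (P x → InConv (λ y → Σ (Fin (suc d)) λ i → PtEq y (q i)) x)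
                  × (InConv (λ y → Σ (Fin (suc d)) λ i → PtEq y (q i)) x → P x))

-- A subgraph of K_{1,n} is a star, so its bi-enumerator is determined by the degree k of
-- the single left vertex: it is 1_k ⊕ (n-k, k). The first block of these n+1 points is
-- the standard basis of ℝ^{n+1}, so they are affinely independent, and the first block
-- of any point x of their convex hull lists its barycentric coordinates. In particular
-- x_k ≤ 1 with equality only at the k-th point, so the functional x ↦ x_k exposes it as
-- a vertex.
module Submission where

open import Defs
open import Data.Nat using (ℕ; _≤_; suc)
open import Data.Fin using (Fin; toℕ)
open import Data.Product using (Σ; _×_)
open import Relation.Binary.PropositionalEquality using (_≡_)

open import Algebra.Bundles using (CommutativeRing)
open import Data.Bool using (Bool; true; false; if_then_else_; not)
open import Data.Empty using (⊥-elim)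
open import Data.Fin using (zero; suc; fromℕ<)
open import Data.Fin.Properties using (toℕ<n; toℕ-fromℕ<)
open import Data.Nat using (zero; z≤n; s≤s; s≤s⁻¹; _∸_; _≡ᵇ_; _<ᵇ_)
open import Data.Nat.Properties using (m≤n⇒m≤1+n; +-∸-assoc; +-identityʳ)
open import Data.Product using (_,_; proj₁; proj₂)
open import Data.Rational using (ℚ; 0ℚ; 1ℚ; _+_; _*_; _<_; nonNegative)
  renaming (_≤_ to _≤ℚ_)
open import Data.Rational.Properties as ℚ using (+-*-commutativeRing)
open import Data.Sum using (inj₁; inj₂)
open import Function using (_∘_)
open import Relation.Binary.Definitions using (tri<; tri≈; tri>)
open import Relation.Binary.PropositionalEquality
  using (refl; sym; trans; cong; cong₂; subst; subst₂; _≢_; module ≡-Reasoning)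
open import Relation.Nullary using (¬_)

open import Algebra.Properties.Group ℚ.+-0-group using (identityˡ-unique; identityʳ-unique)
open import Algebra.Properties.Semiring.Sum (CommutativeRing.semiring +-*-commutativeRing)
  using (sum) renaming (∑-comm to sum-comm)

open ≡-Reasoning

≡ᵇ-refl : ∀ m → (m ≡ᵇ m) ≡ true
≡ᵇ-refl zero    = refl
≡ᵇ-refl (suc m) = ≡ᵇ-refl m

≡ᵇ-sym : ∀ m n → (m ≡ᵇ n) ≡ (n ≡ᵇ m)
≡ᵇ-sym zero    zero    = refl
≡ᵇ-sym zero    (suc n) = refl
≡ᵇ-sym (suc m) zero    = refl
≡ᵇ-sym (suc m) (suc n) = ≡ᵇ-sym m n

count-cong : ∀ {k} {p q : Fin k → Bool} → (∀ i → p i ≡ q i) → count p ≡ count q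
count-cong {zero}  p≗q = refl
count-cong {suc k} p≗q =
  cong₂ Data.Nat._+_ (cong (λ x → if x then 1 else 0) (p≗q zero)) (count-cong (p≗q ∘ suc))

count≤ : ∀ {k} (p : Fin k → Bool) → count p ≤ k
count≤ {zero}  p = z≤n
count≤ {suc k} p with p zero
... | true  = s≤s (count≤ (p ∘ suc))
... | false = m≤n⇒m≤1+n (count≤ (p ∘ suc))

count-not : ∀ {k} (p : Fin k → Bool) → count (not ∘ p) ≡ k ∸ count p
count-not {zero}  p = refl
count-not {suc k} p with p zero
... | true  = count-not (p ∘ suc)
... | false = trans (cong suc (count-not (p ∘ suc))) (sym (+-∸-assoc 1 (count≤ (p ∘ suc))))

count-false : ∀ k → count {k} (λ _ → false) ≡ 0
count-false zero    = refl
count-false (suc k) = count-false k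

count-<ᵇ : ∀ {k} m → m ≤ k → count {k} (λ i → toℕ i <ᵇ m) ≡ m
count-<ᵇ {k}     zero    _         = count-false k
count-<ᵇ {suc k} (suc m) (s≤s m≤k) = cong suc (count-<ᵇ m m≤k)

-- In K_{1,n} the degree of a right vertex is a sum over the single left vertex.
degR-star≡ᵇ0 : ∀ x → ((if x then 1 else 0) Data.Nat.+ 0 ≡ᵇ 0) ≡ not x
degR-star≡ᵇ0 true  = refl
degR-star≡ᵇ0 false = refl

degR-star≡ᵇ1 : ∀ x → ((if x then 1 else 0) Data.Nat.+ 0 ≡ᵇ 1) ≡ x
degR-star≡ᵇ1 true  = refl
degR-star≡ᵇ1 false = refl

b-star : ∀ {n} (G : Graph 1 n) (k : Fin (suc n)) → degL G zero ≡ toℕ k →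
         (j : Idx 1 n) → b G j ≡ target n k j
b-star G k deg≡k (inj₁ i) = begin
  (if degL G zero ≡ᵇ toℕ i then 1 else 0) Data.Nat.+ 0
    ≡⟨ +-identityʳ _ ⟩
  (if degL G zero ≡ᵇ toℕ i then 1 else 0)
    ≡⟨ cong (λ d → if d ≡ᵇ toℕ i then 1 else 0) deg≡k ⟩
  (if toℕ k ≡ᵇ toℕ i then 1 else 0)
    ≡⟨ cong (λ x → if x then 1 else 0) (≡ᵇ-sym (toℕ k) (toℕ i)) ⟩
  (if toℕ i ≡ᵇ toℕ k then 1 else 0) ∎
b-star {n} G k deg≡k (inj₂ zero) =
  trans (count-cong (degR-star≡ᵇ0 ∘ G zero)) (trans (count-not (G zero)) (cong (n ∸_) deg≡k))
b-star G k deg≡k (inj₂ (suc zero)) = trans (count-cong (degR-star≡ᵇ1 ∘ G zero)) deg≡k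

b-classification : ∀ {n} (G : Graph 1 n) →
                   Σ (Fin (suc n)) λ k → (j : Idx 1 n) → b G j ≡ target n k j
b-classification G = fromℕ< deg<1+n , b-star G _ (sym (toℕ-fromℕ< deg<1+n))
  where deg<1+n = s≤s (count≤ (G zero))

b-realisation : ∀ {n} (k : Fin (suc n)) →
                Σ (Graph 1 n) λ G → (j : Idx 1 n) → b G j ≡ target n k j
b-realisation k = (λ _ v → toℕ v <ᵇ toℕ k) , b-star _ k (count-<ᵇ (toℕ k) (s≤s⁻¹ (toℕ<n k)))

Corner : ∀ {m n d} → (Fin d → Pt m n) → Pt m n → Set
Corner {d = d} q y = Σ (Fin d) λ k → PtEq y (q k)

starPoint : (n : ℕ) → Fin (suc n) → Pt 1 n
starPoint n k j = ℕtoℚ (target n k j)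

biEnum⇒corner : ∀ {n} y → BiEnums 1 n y → Corner (starPoint n) y
biEnum⇒corner y (G , y≡bG) with b-classification G
... | k , bG≡target = k , λ j → trans (y≡bG j) (cong ℕtoℚ (bG≡target j))

corner⇒biEnum : ∀ {n} y → Corner (starPoint n) y → BiEnums 1 n y
corner⇒biEnum y (k , y≡target) with b-realisation k
... | G , bG≡target = G , λ j → trans (y≡target j) (cong ℕtoℚ (sym (bG≡target j)))

∑-cong : ∀ {k} {f g : Fin k → ℚ} → (∀ i → f i ≡ g i) → ∑ f ≡ ∑ g
∑-cong {zero}  f≗g = refl
∑-cong {suc k} f≗g = cong₂ _+_ (f≗g zero) (∑-cong (f≗g ∘ suc))

∑≡sum : ∀ {k} (f : Fin k → ℚ) → ∑ f ≡ sum f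
∑≡sum {zero}  f = refl
∑≡sum {suc k} f = cong (f zero +_) (∑≡sum (f ∘ suc))

∑-zero : ∀ k → ∑ {k} (λ _ → 0ℚ) ≡ 0ℚ
∑-zero zero    = refl
∑-zero (suc k) = trans (ℚ.+-identityˡ _) (∑-zero k)

∑-comm : ∀ {k l} (f : Fin k → Fin l → ℚ) →
         ∑ (λ i → ∑ (λ r → f i r)) ≡ ∑ (λ r → ∑ (λ i → f i r))
∑-comm f = begin
  ∑ (λ i → ∑ (λ r → f i r))
    ≡⟨ ∑²≡sum² f ⟩
  sum (λ i → sum (λ r → f i r))
    ≡⟨ sum-comm f ⟩
  sum (λ r → sum (λ i → f i r))
    ≡⟨ sym (∑²≡sum² (λ r i → f i r)) ⟩
  ∑ (λ r → ∑ (λ i → f i r)) ∎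
  where
  ∑²≡sum² : ∀ {k l} (g : Fin k → Fin l → ℚ) → ∑ (λ i → ∑ (g i)) ≡ sum (λ i → sum (g i))
  ∑²≡sum² g = trans (∑-cong (λ i → ∑≡sum (g i))) (∑≡sum (λ i → sum (g i)))

∑-*ˡ : ∀ {k} x (f : Fin k → ℚ) → ∑ (λ i → x * f i) ≡ x * ∑ f
∑-*ˡ {zero}  x f = sym (ℚ.*-zeroʳ x)
∑-*ˡ {suc k} x f = trans (cong (x * f zero +_) (∑-*ˡ x (f ∘ suc))) (sym (ℚ.*-distribˡ-+ x _ _))

∑-*ʳ : ∀ {k} x (f : Fin k → ℚ) → ∑ (λ i → f i * x) ≡ ∑ f * x
∑-*ʳ x f = trans (∑-cong (λ i → ℚ.*-comm (f i) x)) (trans (∑-*ˡ x f) (ℚ.*-comm x _))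

∑-bilinear : ∀ {k l} (u : Fin k → ℚ) (M : Fin k → Fin l → ℚ) (v : Fin l → ℚ) →
             ∑ (λ i → ∑ (λ r → u r * M r i) * v i) ≡ ∑ (λ r → u r * ∑ (λ i → M r i * v i))
∑-bilinear u M v = begin
  ∑ (λ i → ∑ (λ r → u r * M r i) * v i)
    ≡⟨ ∑-cong (λ i → sym (∑-*ʳ (v i) (λ r → u r * M r i))) ⟩
  ∑ (λ i → ∑ (λ r → u r * M r i * v i))
    ≡⟨ ∑-cong (λ i → ∑-cong (λ r → ℚ.*-assoc (u r) (M r i) (v i))) ⟩
  ∑ (λ i → ∑ (λ r → u r * (M r i * v i)))
    ≡⟨ ∑-comm (λ i r → u r * (M r i * v i)) ⟩
  ∑ (λ r → ∑ (λ i → u r * (M r i * v i)))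
    ≡⟨ ∑-cong (λ r → ∑-*ˡ (u r) (λ i → M r i * v i)) ⟩
  ∑ (λ r → u r * ∑ (λ i → M r i * v i)) ∎

∑-nonneg : ∀ {k} (f : Fin k → ℚ) → (∀ i → 0ℚ ≤ℚ f i) → 0ℚ ≤ℚ ∑ f
∑-nonneg {zero}  f f≥0 = ℚ.≤-refl
∑-nonneg {suc k} f f≥0 = ℚ.+-mono-≤ (f≥0 zero) (∑-nonneg (f ∘ suc) (f≥0 ∘ suc))

x≤x+y : ∀ {x y} → 0ℚ ≤ℚ y → x ≤ℚ x + y
x≤x+y {x} y≥0 = subst (_≤ℚ x + _) (ℚ.+-identityʳ x) (ℚ.+-monoʳ-≤ x y≥0)

y≤x+y : ∀ {x y} → 0ℚ ≤ℚ x → y ≤ℚ x + y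
y≤x+y {x} {y} x≥0 = subst (y ≤ℚ_) (ℚ.+-comm y x) (x≤x+y x≥0)

term≤∑ : ∀ {k} (f : Fin k → ℚ) → (∀ i → 0ℚ ≤ℚ f i) → ∀ i → f i ≤ℚ ∑ f
term≤∑ f f≥0 zero    = x≤x+y (∑-nonneg (f ∘ suc) (f≥0 ∘ suc))
term≤∑ f f≥0 (suc i) = ℚ.≤-trans (term≤∑ (f ∘ suc) (f≥0 ∘ suc) i) (y≤x+y (f≥0 zero))

∑≡0⇒≡0 : ∀ {k} (f : Fin k → ℚ) → (∀ i → 0ℚ ≤ℚ f i) → ∑ f ≡ 0ℚ → ∀ i → f i ≡ 0ℚ
∑≡0⇒≡0 f f≥0 ∑f≡0 i = ℚ.≤-antisym (subst (f i ≤ℚ_) ∑f≡0 (term≤∑ f f≥0 i)) (f≥0 i)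

*-nonneg : ∀ {x y} → 0ℚ ≤ℚ x → 0ℚ ≤ℚ y → 0ℚ ≤ℚ x * y
*-nonneg {x} {y} x≥0 y≥0 =
  ℚ.nonNegative⁻¹ (x * y) {{ℚ.nonNeg*nonNeg⇒nonNeg x {{nonNegative x≥0}} y {{nonNegative y≥0}}}}

ℕtoℚ-nonneg : ∀ k → 0ℚ ≤ℚ ℕtoℚ k
ℕtoℚ-nonneg k = ℚ.nonNegative⁻¹ _ {{ℚ.normalize-nonNeg k 1}}

≤∧≢⇒< : ∀ {x y} → x ≤ℚ y → x ≢ y → x < y
≤∧≢⇒< {x} {y} x≤y x≢y with ℚ.<-cmp x y
... | tri< x<y _ _ = x<y
... | tri≈ _ x≡y _ = ⊥-elim (x≢y x≡y)
... | tri> _ _ x>y = ⊥-elim (x≢y (ℚ.≤-antisym x≤y (ℚ.<⇒≤ x>y)))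

-- Kronecker delta, in the shape in which it occurs in `target`.
δ : ∀ {k} → Fin k → Fin k → ℚ
δ i k = ℕtoℚ (if toℕ i ≡ᵇ toℕ k then 1 else 0)

δ-sym : ∀ {k} (i l : Fin k) → δ i l ≡ δ l i
δ-sym i l = cong (λ x → ℕtoℚ (if x then 1 else 0)) (≡ᵇ-sym (toℕ i) (toℕ l))

δ-refl : ∀ {k} (i : Fin k) → δ i i ≡ 1ℚ
δ-refl i = cong (λ x → ℕtoℚ (if x then 1 else 0)) (≡ᵇ-refl (toℕ i))

∑-δ : ∀ {k} (l : Fin k) (f : Fin k → ℚ) → ∑ (λ i → δ i l * f i) ≡ f l
∑-δ {suc k} zero f = begin
  1ℚ * f zero + ∑ (λ i → 0ℚ * f (suc i))
    ≡⟨ cong₂ _+_ (ℚ.*-identityˡ (f zero)) (∑-cong (ℚ.*-zeroˡ ∘ f ∘ suc)) ⟩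
  f zero + ∑ {k} (λ _ → 0ℚ)
    ≡⟨ trans (cong (f zero +_) (∑-zero k)) (ℚ.+-identityʳ (f zero)) ⟩
  f zero ∎
∑-δ (suc l) f = trans (cong₂ _+_ (ℚ.*-zeroˡ (f zero)) (∑-δ l (f ∘ suc))) (ℚ.+-identityˡ _)

∑≡term⇒concentrated : ∀ {k} (f : Fin k → ℚ) → (∀ i → 0ℚ ≤ℚ f i) →
                      ∀ l → ∑ f ≡ f l → ∀ i → f i ≡ δ i l * f l
∑≡term⇒concentrated f f≥0 zero    ∑f≡f₀ zero    = sym (ℚ.*-identityˡ _)
∑≡term⇒concentrated f f≥0 zero    ∑f≡f₀ (suc i) = begin
  f (suc i)
    ≡⟨ ∑≡0⇒≡0 (f ∘ suc) (f≥0 ∘ suc) (identityʳ-unique (f zero) _ ∑f≡f₀) i ⟩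
  0ℚ
    ≡⟨ sym (ℚ.*-zeroˡ (f zero)) ⟩
  0ℚ * f zero ∎
∑≡term⇒concentrated f f≥0 (suc l) ∑f≡fₗ = λ
  { zero    → trans f₀≡0 (sym (ℚ.*-zeroˡ (f (suc l))))
  ; (suc i) → ∑≡term⇒concentrated (f ∘ suc) (f≥0 ∘ suc) l (trans (sym ∑f≡∑f′) ∑f≡fₗ) i
  }
  where
  ∑f′ = ∑ (f ∘ suc)
  ∑f≡∑f′ : f zero + ∑f′ ≡ ∑f′
  ∑f≡∑f′ = ℚ.≤-antisym (subst (_≤ℚ ∑f′) (sym ∑f≡fₗ) (term≤∑ (f ∘ suc) (f≥0 ∘ suc) l))
                        (y≤x+y (f≥0 zero))
  f₀≡0 : f zero ≡ 0ℚ
  f₀≡0 = identityˡ-unique (f zero) ∑f′ ∑f≡∑f′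

InConv-mono : ∀ {m n} {S S′ : Pt m n → Set} → (∀ y → S y → S′ y) →
              ∀ x → InConv S x → InConv S′ x
InConv-mono S⊆S′ x (r , p , w , p∈S , w≥0 , ∑w≡1 , x≡∑wp) =
  r , p , w , (λ i → S⊆S′ (p i) (p∈S i)) , w≥0 , ∑w≡1 , x≡∑wp

module UnitSimplex {m n} (q : Fin (suc n) → Pt m n)
                   (q-unit : ∀ i k → q k (inj₁ i) ≡ δ i k)
                   (S : Pt m n → Set)
                   (S⊆corners : ∀ y → S y → Corner q y)
                   (corners⊆S : ∀ y → Corner q y → S y) where

  Barycentric : Pt m n → Set
  Barycentric x = (∀ i → 0ℚ ≤ℚ x (inj₁ i)) × ∑ (λ i → x (inj₁ i)) ≡ 1ℚ
                × (∀ j → x j ≡ ∑ (λ i → x (inj₁ i) * q i j))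

  corner-barycentric : ∀ y → S y → Barycentric y
  corner-barycentric y y∈S with S⊆corners y y∈S
  ... | k , y≡qₖ = y≥0 , ∑y≡1 , y≡∑yq
    where
    yᵢ≡δ : ∀ i → y (inj₁ i) ≡ δ i k
    yᵢ≡δ i = trans (y≡qₖ (inj₁ i)) (q-unit i k)
    y≥0 : ∀ i → 0ℚ ≤ℚ y (inj₁ i)
    y≥0 i = subst (0ℚ ≤ℚ_) (sym (yᵢ≡δ i)) (ℕtoℚ-nonneg (if toℕ i ≡ᵇ toℕ k then 1 else 0))
    ∑y≡1 : ∑ (λ i → y (inj₁ i)) ≡ 1ℚ
    ∑y≡1 = trans (∑-cong (λ i → trans (yᵢ≡δ i) (sym (ℚ.*-identityʳ _)))) (∑-δ k (λ _ → 1ℚ))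
    y≡∑yq : ∀ j → y j ≡ ∑ (λ i → y (inj₁ i) * q i j)
    y≡∑yq j = sym (trans (∑-cong (λ i → cong (_* q i j) (yᵢ≡δ i)))
                         (trans (∑-δ k (λ i → q i j)) (sym (y≡qₖ j))))

  conv-barycentric : ∀ x → InConv S x → Barycentric x
  conv-barycentric x (r , p , w , p∈S , w≥0 , ∑w≡1 , x≡∑wp) = x≥0 , ∑x≡1 , x≡∑xq
    where
    pᵢ : Fin r → Fin (suc n) → ℚ
    pᵢ s i = p s (inj₁ i)
    p-bary : ∀ s → Barycentric (p s)
    p-bary s = corner-barycentric (p s) (p∈S s)
    x≥0 : ∀ i → 0ℚ ≤ℚ x (inj₁ i)
    x≥0 i = subst (0ℚ ≤ℚ_) (sym (x≡∑wp (inj₁ i)))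
                  (∑-nonneg _ (λ s → *-nonneg (w≥0 s) (proj₁ (p-bary s) i)))
    ∑pᵢ≡1 : ∀ s → ∑ (λ i → pᵢ s i * 1ℚ) ≡ 1ℚ
    ∑pᵢ≡1 s = trans (∑-cong (ℚ.*-identityʳ ∘ pᵢ s)) (proj₁ (proj₂ (p-bary s)))
    ∑x≡1 : ∑ (λ i → x (inj₁ i)) ≡ 1ℚ
    ∑x≡1 = begin
      ∑ (λ i → x (inj₁ i))
        ≡⟨ ∑-cong (λ i → trans (x≡∑wp (inj₁ i)) (sym (ℚ.*-identityʳ _))) ⟩
      ∑ (λ i → ∑ (λ s → w s * pᵢ s i) * 1ℚ)
        ≡⟨ ∑-bilinear w pᵢ (λ _ → 1ℚ) ⟩
      ∑ (λ s → w s * ∑ (λ i → pᵢ s i * 1ℚ))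
        ≡⟨ ∑-cong (λ s → cong (w s *_) (∑pᵢ≡1 s)) ⟩
      ∑ (λ s → w s * 1ℚ)
        ≡⟨ trans (∑-cong (ℚ.*-identityʳ ∘ w)) ∑w≡1 ⟩
      1ℚ ∎
    x≡∑xq : ∀ j → x j ≡ ∑ (λ i → x (inj₁ i) * q i j)
    x≡∑xq j = sym (begin
      ∑ (λ i → x (inj₁ i) * q i j)
        ≡⟨ ∑-cong (λ i → cong (_* q i j) (x≡∑wp (inj₁ i))) ⟩
      ∑ (λ i → ∑ (λ s → w s * pᵢ s i) * q i j)
        ≡⟨ ∑-bilinear w pᵢ (λ i → q i j) ⟩
      ∑ (λ s → w s * ∑ (λ i → pᵢ s i * q i j))
        ≡⟨ ∑-cong (λ s → cong (w s *_) (sym (proj₂ (proj₂ (p-bary s)) j))) ⟩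
      ∑ (λ s → w s * p s j)
        ≡⟨ sym (x≡∑wp j) ⟩
      x j ∎)

  corner∈conv : ∀ k → InConv S (q k)
  corner∈conv k = 1 , (λ _ → q k) , (λ _ → 1ℚ) , (λ _ → corners⊆S (q k) (k , λ _ → refl)) ,
                  (λ _ → ℕtoℚ-nonneg 1) , ℚ.+-identityʳ 1ℚ ,
                  (λ j → sym (trans (ℚ.+-identityʳ _) (ℚ.*-identityˡ _)))

  barycentric-unit⇒corner : ∀ x → Barycentric x → ∀ k → x (inj₁ k) ≡ 1ℚ → PtEq x (q k)
  barycentric-unit⇒corner x (x≥0 , ∑x≡1 , x≡∑xq) k xₖ≡1 j = begin
    x j
      ≡⟨ x≡∑xq j ⟩
    ∑ (λ i → x (inj₁ i) * q i j)
      ≡⟨ ∑-cong (λ i → cong (_* q i j) (xᵢ≡δ i)) ⟩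
    ∑ (λ i → δ i k * q i j)
      ≡⟨ ∑-δ k (λ i → q i j) ⟩
    q k j ∎
    where
    xᵢ≡δ : ∀ i → x (inj₁ i) ≡ δ i k
    xᵢ≡δ i = trans (∑≡term⇒concentrated (λ i → x (inj₁ i)) x≥0 k (trans ∑x≡1 (sym xₖ≡1)) i)
                   (trans (cong (δ i k *_) xₖ≡1) (ℚ.*-identityʳ _))

  coordinate : Fin (suc n) → Pt m n
  coordinate k (inj₁ i) = δ i k
  coordinate k (inj₂ _) = 0ℚ

  dot-coordinate : ∀ k x → dot (coordinate k) x ≡ x (inj₁ k)
  dot-coordinate k x = begin
    ∑ (λ i → δ i k * x (inj₁ i)) + ∑ (λ i → 0ℚ * x (inj₂ i))
      ≡⟨ cong₂ _+_ (∑-δ k (x ∘ inj₁)) (∑-cong (ℚ.*-zeroˡ ∘ x ∘ inj₂)) ⟩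
    x (inj₁ k) + ∑ {suc m} (λ _ → 0ℚ)
      ≡⟨ cong (x (inj₁ k) +_) (∑-zero (suc m)) ⟩
    x (inj₁ k) + 0ℚ
      ≡⟨ ℚ.+-identityʳ _ ⟩
    x (inj₁ k) ∎

  corner-isVertex : ∀ k → IsVertex (InConv S) (q k)
  corner-isVertex k = corner∈conv k , coordinate k , exposed
    where
    qₖₖ≡1 : q k (inj₁ k) ≡ 1ℚ
    qₖₖ≡1 = trans (q-unit k k) (δ-refl k)
    exposed : ∀ y → InConv S y → ¬ PtEq y (q k) →
              dot (coordinate k) y < dot (coordinate k) (q k)
    exposed y y∈conv y≢qₖ =
      subst₂ _<_ (sym (dot-coordinate k y)) (sym (trans (dot-coordinate k (q k)) qₖₖ≡1))
        (≤∧≢⇒< (subst (y (inj₁ k) ≤ℚ_) ∑y≡1 (term≤∑ (y ∘ inj₁) y≥0 k))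
               (y≢qₖ ∘ barycentric-unit⇒corner y bary k))
      where
      bary = conv-barycentric y y∈conv
      y≥0 = proj₁ bary
      ∑y≡1 = proj₁ (proj₂ bary)

  corners-affInd : AffInd q
  corners-affInd l _ ∑lq≡0 i = begin
    l i
      ≡⟨ sym (∑-δ i l) ⟩
    ∑ (λ k → δ k i * l k)
      ≡⟨ ∑-cong (λ k → cong (_* l k) (trans (δ-sym k i) (sym (q-unit i k)))) ⟩
    ∑ (λ k → q k (inj₁ i) * l k)
      ≡⟨ ∑-cong (λ k → ℚ.*-comm (q k (inj₁ i)) (l k)) ⟩
    ∑ (λ k → l k * q k (inj₁ i))
      ≡⟨ ∑lq≡0 (inj₁ i) ⟩
    0ℚ ∎

  conv-isSimplex : IsSimplex n (InConv S)
  conv-isSimplex = q , corners-affInd ,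
    λ x → InConv-mono S⊆corners x , InConv-mono corners⊆S x

proposition3p1 : (n : ℕ) → 1 ≤ n →
    ((G : Graph 1 n) → Σ (Fin (suc n)) λ k → (j : Idx 1 n) → b G j ≡ target n k j)
    × ((k : Fin (suc n)) → Σ (Graph 1 n) λ G → (j : Idx 1 n) → b G j ≡ target n k j)
    × ((k : Fin (suc n)) → IsVertex (InB 1 n) (λ j → ℕtoℚ (target n k j)))
    × IsSimplex n (InB 1 n)
proposition3p1 n _ =
  b-classification , b-realisation , corner-isVertex , conv-isSimplex
  where open UnitSimplex (starPoint n) (λ _ _ → refl) (BiEnums 1 n) biEnum⇒corner corner⇒biEnum
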